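{- Let $G$ be a chordal graph with clique forest $\mathcal{T}$, and let $a_1$ be the number of vertices of degree at least 3 in $\mathcal{T}$. Then $\alpha(G) \ge a_1$.
   Context: $G$ is a finite chordal graph (every cycle of length at least 4 has a chord). A clique forest of $G$ is a forest whose vertex set is the family of maximal cliques of $G$, such that for every node $v$ of $G$ the maximal cliques containing $v$ induce a subtree (the paper fixes a particular one, the maximum weight spanning forest of the weighted clique intersection graph with ID-based tie-breaking). $\alpha(G)$ is the maximum size of an independent set in $G$. -}

module Defs where

open import Data.Nat using (ℕ; zero; suc; _≤_; _≤ᵇ_)
open import Data.Fin using (Fin; zero; suc; toℕ; fromℕ; inject₁)
open import Data.Fin.Subset using (Subset; _∈_; _∉_; _⊆_; ∣_∣)
open import Data.Vec using (tabulate)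
open import Data.Bool using (Bool; true; false)
open import Data.Product using (Σ; ∃; _×_; _,_)
open import Data.Sum using (_⊎_)
open import Relation.Binary.PropositionalEquality using (_≡_; _≢_)
open import Relation.Nullary using (¬_)
open import Function.Definitions using (Injective)

record Graph (n : ℕ) : Set where
  field
    adj    : Fin n → Fin n → Bool
    sym    : ∀ i j → adj i j ≡ adj j i
    irrefl : ∀ i → adj i i ≡ false
open Graph public

Edge : ∀ {n} → Graph n → Fin n → Fin n → Set
Edge G i j = adj G i j ≡ true

-- A cycle of length k = suc k' in G: an injective sequence of vertices
-- c 0, ..., c k' with consecutive ones adjacent and c k' adjacent to c 0.
record IsCycle {n : ℕ} (G : Graph n) (k' : ℕ) (c : Fin (suc k') → Fin n) : Set where
  field
    injective : Injective _≡_ _≡_ c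
    steps     : ∀ (i : Fin k') → Edge G (c (inject₁ i)) (c (suc i))
    closing   : Edge G (c (fromℕ k')) (c zero)

Consecutive : (k : ℕ) → ℕ → ℕ → Set
Consecutive k p q = (q ≡ suc p) ⊎ (p ≡ suc q)
                  ⊎ ((p ≡ 0) × (suc q ≡ k)) ⊎ ((q ≡ 0) × (suc p ≡ k))

Chordal : ∀ {n} → Graph n → Set
Chordal G = ∀ (k' : ℕ) → 3 ≤ k' → (c : Fin (suc k') → _) → IsCycle G k' c →
  ∃ λ i → ∃ λ j → Edge G (c i) (c j) × ¬ Consecutive (suc k') (toℕ i) (toℕ j)

-- Forest: a graph with no cycle (cycles in a simple graph have length ≥ 3).
Forest : ∀ {m} → Graph m → Set
Forest T = ∀ (k' : ℕ) → 2 ≤ k' → (c : Fin (suc k') → _) → ¬ IsCycle T k' c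

IsClique : ∀ {n} → Graph n → Subset n → Set
IsClique G S = ∀ i j → i ∈ S → j ∈ S → i ≢ j → Edge G i j

IsMaximalClique : ∀ {n} → Graph n → Subset n → Set
IsMaximalClique G S = IsClique G S × (∀ S' → IsClique G S' → S ⊆ S' → S' ≡ S)

IsIndependent : ∀ {n} → Graph n → Subset n → Set
IsIndependent G S = ∀ i j → i ∈ S → j ∈ S → adj G i j ≡ false

data Reach {m : ℕ} (T : Graph m) (P : Fin m → Set) : Fin m → Fin m → Set where
  here : ∀ {i} → P i → Reach T P i i
  step : ∀ {i j k} → P i → Edge T i j → Reach T P j k → Reach T P i k

record CliqueForest {n : ℕ} (G : Graph n) : Set where
  field
    m        : ℕ
    tree     : Graph m
    forest   : Forest tree
    K        : Fin m → Subset n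
    K-inj    : Injective _≡_ _≡_ K
    K-max    : ∀ i → IsMaximalClique G (K i)
    K-surj   : ∀ S → IsMaximalClique G S → ∃ λ i → K i ≡ S
    subtree  : ∀ v i j → v ∈ K i → v ∈ K j → Reach tree (λ l → v ∈ K l) i j

degree : ∀ {m} → Graph m → Fin m → ℕ
degree T i = ∣ tabulate (adj T i) ∣

a₁ : ∀ {m} → Graph m → ℕ
a₁ T = ∣ tabulate (λ i → 3 ≤ᵇ degree T i) ∣

module Submission where

-- In a forest the nodes of degree ≥ 3 are at most as many as the nodes of
-- degree ≤ 1: every nonempty forest has a leaf, and deleting a leaf preserves
-- the inequality. A leaf K of the clique forest has a private vertex, lying in
-- no other maximal clique: K ⊈ K′ for its neighbour K′, and by the subtree
-- property a vertex of K ∖ K′ can lie in no clique beyond K′. Private vertices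
-- of distinct leaves are non-adjacent, because an edge lies in some maximal
-- clique, which would have to be both leaves.

open import Defs hiding (sym)
open import Data.Bool using (Bool; true; false; _∧_; T; if_then_else_)
open import Data.Bool.Properties using (∧-identityʳ; ∧-zeroʳ) renaming (_≟_ to _≟ᵇ_)
open import Data.Empty using (⊥-elim)
open import Data.Fin using (Fin; zero; suc; toℕ; fromℕ; inject₁; fromℕ<)
open import Data.Fin.Properties
  using (any?; all?; pigeonhole; suc-injective; toℕ-injective; toℕ<n; toℕ-fromℕ; toℕ-inject₁; toℕ-fromℕ<)
  renaming (_≟_ to _≟ᶠ_)
open import Data.Fin.Subset using (Subset; _∈_; _∉_; _⊆_; _⊃_; ∣_∣; ⁅_⁆; _∪_)
open import Data.Fin.Subset.Induction using (Acc; acc; ⊃-wellFounded)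
open import Data.Fin.Subset.Properties
  using (_∈?_; _⊂?_; anySubset?; ⊆-antisym; ⊆-trans; x∈⁅x⁆; x∈⁅y⁆⇒x≡y; x∈p∪q⁻; x∈p∪q⁺)
open import Data.Nat using (ℕ; zero; suc; _+_; _≤_; _<_; _≤ᵇ_; pred; z≤n; s≤s; z<s; s≤s⁻¹)
open import Data.Nat.Properties
  using ( ≤-refl; ≤-reflexive; ≤ᵇ⇒≤; ≤-trans; <-irrefl; _≤?_; ≰⇒>; m≤n⇒m≤1+n; n<1+n; m<1+n⇒m<n∨m≡n
        ; m<1+n⇒m≤n; m≤n⇒∃[o]m+o≡n; +-mono-≤; +-monoˡ-≤; +-monoʳ-≤; m≤n+m; ≤⇒≯; module ≤-Reasoning
        ; +-suc; +-comm; +-identityʳ; +-cancelˡ-≡; +-commutativeSemigroup)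
open import Algebra.Properties.CommutativeSemigroup +-commutativeSemigroup using (x∙yz≈y∙xz)
open import Data.Product using (∃; ∃₂; _×_; _,_; proj₁; proj₂)
open import Data.Sum using (_⊎_; inj₁; inj₂)
open import Data.Vec using ([]; tabulate)
open import Data.Vec.Properties using (lookup∘tabulate; []=⇒lookup)
open import Function using (_∘_; id)
open import Relation.Binary.PropositionalEquality
  using (_≡_; _≢_; _≗_; refl; sym; trans; cong; cong₂; subst; subst₂; module ≡-Reasoning)
open import Relation.Nullary using (¬_; yes; no; does; ¬?)
open import Relation.Nullary.Decidable using (dec-true; _×-dec_; _→-dec_)
open import Relation.Unary using (Decidable)

[_] : Bool → ℕ
[ true ]  = 1
[ false ] = 0

count : ∀ {m} → (Fin m → Bool) → ℕ
count {zero}  f = 0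
count {suc m} f = [ f zero ] + count (f ∘ suc)

∣tabulate∣≡count : ∀ {m} (f : Fin m → Bool) → ∣ tabulate f ∣ ≡ count f
∣tabulate∣≡count {zero}  f = refl
∣tabulate∣≡count {suc m} f with f zero
... | true  = cong suc (∣tabulate∣≡count (f ∘ suc))
... | false = ∣tabulate∣≡count (f ∘ suc)

count-cong : ∀ {m} {f g : Fin m → Bool} → f ≗ g → count f ≡ count g
count-cong {zero}  f≗g = refl
count-cong {suc m} f≗g = cong₂ _+_ (cong [_] (f≗g zero)) (count-cong (f≗g ∘ suc))

[]-mono : ∀ {a b} → (a ≡ true → b ≡ true) → [ a ] ≤ [ b ]
[]-mono {false} a⇒b = z≤n
[]-mono {true}  a⇒b rewrite a⇒b refl = ≤-refl

count-mono : ∀ {m} {f g : Fin m → Bool} → (∀ i → f i ≡ true → g i ≡ true) → count f ≤ count g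
count-mono {zero}  f⇒g = z≤n
count-mono {suc m} f⇒g = +-mono-≤ ([]-mono (f⇒g zero)) (count-mono (f⇒g ∘ suc))

count≡0 : ∀ {m} {f : Fin m → Bool} → (∀ i → f i ≡ false) → count f ≡ 0
count≡0 {zero}      none = refl
count≡0 {suc m} {f} none rewrite none zero = count≡0 (none ∘ suc)

count-witness : ∀ {m} {f : Fin m → Bool} → 0 < count f → ∃ λ i → f i ≡ true
count-witness {suc m} {f} pos with f zero in f₀
... | true  = zero , f₀
... | false = let i , fi = count-witness pos in suc i , fi

count-pos : ∀ {m} {f : Fin m → Bool} {i} → f i ≡ true → 0 < count f
count-pos {suc m} {f} {zero}  fi rewrite fi = z<s
count-pos {suc m} {f} {suc i} fi = ≤-trans (count-pos {f = f ∘ suc} fi) (m≤n+m _ [ f zero ])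

count≡0⁻ : ∀ {m} {f : Fin m → Bool} → count f ≡ 0 → ∀ i → f i ≡ false
count≡0⁻ {f = f} none i with f i in fi
... | false = refl
... | true  = ⊥-elim (<-irrefl (sym none) (count-pos {f = f} fi))

true≢false : true ≢ false
true≢false ()

∧-true⁻ : ∀ {a b} → a ∧ b ≡ true → a ≡ true × b ≡ true
∧-true⁻ {true} {true} _ = refl , refl

erase : ∀ {m} → (Fin m → Bool) → Fin m → Fin m → Bool
erase f x i = if does (i ≟ᶠ x) then false else f i

erase-self : ∀ {m} (f : Fin m → Bool) x → erase f x x ≡ false
erase-self f x with x ≟ᶠ x
... | yes _   = refl
... | no x≢x = ⊥-elim (x≢x refl)

erase-≢ : ∀ {m} {f : Fin m → Bool} {x i} → i ≢ x → erase f x i ≡ f i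
erase-≢ {x = x} {i} i≢x with i ≟ᶠ x
... | yes i≡x = ⊥-elim (i≢x i≡x)
... | no _    = refl

erase-true⁻ : ∀ {m} {f : Fin m → Bool} {x i} → erase f x i ≡ true → f i ≡ true × i ≢ x
erase-true⁻ {x = x} {i} e with i ≟ᶠ x
erase-true⁻ () | yes _
... | no i≢x = e , i≢x

erase-cong : ∀ {m} {f g : Fin m → Bool} {x} → (∀ i → i ≢ x → f i ≡ g i) → erase f x ≗ erase g x
erase-cong {x = x} agree i with i ≟ᶠ x
... | yes _   = refl
... | no i≢x = agree i i≢x

count-erase : ∀ {m} (f : Fin m → Bool) x → count f ≡ [ f x ] + count (erase f x)
count-erase {suc m} f zero    = refl
count-erase {suc m} f (suc x) = begin
  [ f zero ] + count (f ∘ suc)                                   ≡⟨ cong ([ f zero ] +_) (count-erase (f ∘ suc) x) ⟩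
  [ f zero ] + ([ f (suc x) ] + count (erase (f ∘ suc) x))       ≡⟨ x∙yz≈y∙xz [ f zero ] [ f (suc x) ] _ ⟩
  [ f (suc x) ] + ([ f zero ] + count (erase (f ∘ suc) x))       ∎
  where open ≡-Reasoning

count-erase-active : ∀ {m} {f : Fin m → Bool} {x} → f x ≡ true → count f ≡ suc (count (erase f x))
count-erase-active {f = f} {x} fx = trans (count-erase f x) (cong (λ b → [ b ] + count (erase f x)) fx)

count-split₁ : ∀ {m} {f g : Fin m → Bool} {x a b} → (∀ i → i ≢ x → f i ≡ g i) → f x ≡ a → g x ≡ b →
               ∃ λ R → count f ≡ [ a ] + R × count g ≡ [ b ] + R
count-split₁ {f = f} {g} {x} agree fx gx =
  count (erase f x) ,
  trans (count-erase f x) (cong (λ c → [ c ] + count (erase f x)) fx) ,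
  trans (count-erase g x) (cong₂ (λ c r → [ c ] + r) gx (count-cong (λ i → sym (erase-cong agree i))))

count-split₂ : ∀ {m} {f g : Fin m → Bool} {x u a b a′ b′} → x ≢ u →
               (∀ i → i ≢ x → i ≢ u → f i ≡ g i) → f x ≡ a → f u ≡ b → g x ≡ a′ → g u ≡ b′ →
               ∃ λ R → count f ≡ [ a ] + ([ b ] + R) × count g ≡ [ a′ ] + ([ b′ ] + R)
count-split₂ {f = f} {g} {x} {u} x≢u agree fx fu gx gu =
  let R , ef , eg = count-split₁ {f = erase f x} {g = erase g x} {x = u}
                      agree-off-u
                      (trans (erase-≢ {f = f} (x≢u ∘ sym)) fu) (trans (erase-≢ {f = g} (x≢u ∘ sym)) gu)
  in R , trans (count-erase f x) (cong₂ (λ c r → [ c ] + r) fx ef)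
       , trans (count-erase g x) (cong₂ (λ c r → [ c ] + r) gx eg)
  where
  agree-off-u : ∀ i → i ≢ u → erase f x i ≡ erase g x i
  agree-off-u i i≢u with i ≟ᶠ x
  ... | yes _   = refl
  ... | no i≢x = agree i i≢x i≢u

≤ᵇ-true⇒≤ : ∀ {m n} → (m ≤ᵇ n) ≡ true → m ≤ n
≤ᵇ-true⇒≤ {m} {n} m≤ᵇn = ≤ᵇ⇒≤ m n (subst T (sym m≤ᵇn) _)

[]≤1 : ∀ b → [ b ] ≤ 1
[]≤1 true  = ≤-refl
[]≤1 false = z≤n

count-unique : ∀ {m} {f : Fin m → Bool} {y z} → count f ≤ 1 → f y ≡ true → f z ≡ true → y ≡ z
count-unique {f = f} {y} {z} count≤1 fy fz with z ≟ᶠ y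
... | yes z≡y = sym z≡y
... | no z≢y  = ⊥-elim (≤⇒≯ rest≤0 (count-pos {f = erase f y} (trans (erase-≢ {f = f} z≢y) fz)))
  where
  rest≤0 : count (erase f y) ≤ 0
  rest≤0 = s≤s⁻¹ (subst (_≤ 1) (count-erase-active {f = f} fy) count≤1)

count-avoid : ∀ {m} {f : Fin m → Bool} → 2 ≤ count f → ∀ y → ∃ λ z → f z ≡ true × z ≢ y
count-avoid {f = f} two y =
  let z , ez = count-witness {f = erase f y} rest>0 in z , erase-true⁻ {f = f} ez
  where
  rest>0 : 0 < count (erase f y)
  rest>0 = s≤s⁻¹ (begin
    2                               ≤⟨ two ⟩
    count f                         ≡⟨ count-erase f y ⟩
    [ f y ] + count (erase f y)     ≤⟨ +-monoˡ-≤ _ ([]≤1 (f y)) ⟩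
    1 + count (erase f y)           ∎)
    where open ≤-Reasoning

count-injection : ∀ {m n} {f : Fin m → Bool} {g : Fin n → Bool} (p : Fin m → Fin n) →
                  (∀ x → f x ≡ true → g (p x) ≡ true) →
                  (∀ {x y} → f x ≡ true → f y ≡ true → p x ≡ p y → x ≡ y) → count f ≤ count g
count-injection {zero}              p f⇒g inj = z≤n
count-injection {suc m} {f = f} {g} p f⇒g inj with f zero in f₀
... | false = count-injection (p ∘ suc) (f⇒g ∘ suc) (λ fx fy → suc-injective ∘ inj fx fy)
... | true  = begin
  1 + count (f ∘ suc)                         ≤⟨ s≤s (count-injection (p ∘ suc) f⇒g′ (λ fx fy → suc-injective ∘ inj fx fy)) ⟩
  1 + count (erase g (p zero))                ≡⟨ cong (λ c → [ c ] + count (erase g (p zero))) (f⇒g zero f₀) ⟨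
  [ g (p zero) ] + count (erase g (p zero))   ≡⟨ count-erase g (p zero) ⟨
  count g                                     ∎
  where
  open ≤-Reasoning
  f⇒g′ : ∀ x → f (suc x) ≡ true → erase g (p zero) (p (suc x)) ≡ true
  f⇒g′ x fx = trans (erase-≢ {f = g} (λ p≡p → zero≢suc (inj f₀ fx (sym p≡p)))) (f⇒g (suc x) fx)
    where
    zero≢suc : zero ≢ suc x
    zero≢suc ()

inImage : ∀ {m n} → (Fin m → Bool) → (Fin m → Fin n) → Fin n → Bool
inImage L p v = does (any? λ x → (L x ≟ᵇ true) ×-dec (p x ≟ᶠ v))

image : ∀ {m n} → (Fin m → Bool) → (Fin m → Fin n) → Subset n
image L p = tabulate (inImage L p)

∈-image⁻ : ∀ {m n} {L : Fin m → Bool} {p : Fin m → Fin n} {v} → v ∈ image L p → ∃ λ x → L x ≡ true × p x ≡ v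
∈-image⁻ {L = L} {p} {v} v∈image with any? (λ x → (L x ≟ᵇ true) ×-dec (p x ≟ᶠ v))
      | trans (sym (lookup∘tabulate (inImage L p) v)) ([]=⇒lookup v∈image)
... | yes witness | _ = witness

count≤∣image∣ : ∀ {m n} {L : Fin m → Bool} {p : Fin m → Fin n} →
                (∀ {x y} → L x ≡ true → L y ≡ true → p x ≡ p y → x ≡ y) → count L ≤ ∣ image L p ∣
count≤∣image∣ {L = L} {p} inj = subst (count L ≤_) (sym (∣tabulate∣≡count (inImage L p)))
  (count-injection {g = inImage L p} p (λ x Lx → dec-true (any? _) (x , Lx , refl)) inj)

-- Walks in forests

InjectiveBelow : ∀ {A : Set} → (ℕ → A) → ℕ → Set
InjectiveBelow w j = ∀ {a b} → a < j → b < j → w a ≡ w b → a ≡ b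

injectiveBelow-or-repeats : ∀ {m} (w : ℕ → Fin m) j →
  InjectiveBelow w j ⊎ ∃₂ λ i j′ → i < j′ × w i ≡ w j′ × InjectiveBelow w j′
injectiveBelow-or-repeats w zero = inj₁ λ ()
injectiveBelow-or-repeats w (suc j) with injectiveBelow-or-repeats w j
... | inj₂ repeat = inj₂ repeat
... | inj₁ inj with any? (λ (a : Fin j) → w (toℕ a) ≟ᶠ w j)
...   | yes (a , wa≡wj) = inj₂ (toℕ a , j , toℕ<n a , wa≡wj , inj)
...   | no ¬repeat      = inj₁ inj′
  where
  fresh : ∀ {b} → b < j → w b ≢ w j
  fresh b<j wb≡wj = ¬repeat (fromℕ< b<j , trans (cong w (toℕ-fromℕ< b<j)) wb≡wj)
  inj′ : InjectiveBelow w (suc j)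
  inj′ a<1+j b<1+j wa≡wb with m<1+n⇒m<n∨m≡n a<1+j | m<1+n⇒m<n∨m≡n b<1+j
  ... | inj₁ a<j  | inj₁ b<j  = inj a<j b<j wa≡wb
  ... | inj₁ a<j  | inj₂ refl = ⊥-elim (fresh a<j wa≡wb)
  ... | inj₂ refl | inj₁ b<j  = ⊥-elim (fresh b<j (sym wa≡wb))
  ... | inj₂ refl | inj₂ refl = refl

first-repetition : ∀ {m} (w : ℕ → Fin m) →
  ∃₂ λ i d → w i ≡ w (suc (i + d)) × InjectiveBelow w (suc (i + d))
first-repetition {m} w with injectiveBelow-or-repeats w (suc m)
... | inj₁ inj =
  let a , b , a<b , wa≡wb = pigeonhole (n<1+n m) (w ∘ toℕ)
  in ⊥-elim (<-irrefl (inj (toℕ<n a) (toℕ<n b) wa≡wb) a<b)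
... | inj₂ (i , j , i<j , wi≡wj , inj) with m≤n⇒∃[o]m+o≡n i<j
...   | d , refl = i , d , wi≡wj , inj

loop-free : ∀ {n} (G : Graph n) {v} → ¬ Edge G v v
loop-free G {v} e = true≢false (trans (sym e) (irrefl G v))

-- Effect on (branching nodes, leaves) of deleting a leaf whose neighbour has degree suc d.
degree-decrement-balance : ∀ d {h l} → [ 3 ≤ᵇ d ] + h ≤ [ d ≤ᵇ 1 ] + l →
                           [ 3 ≤ᵇ suc d ] + h ≤ suc ([ suc d ≤ᵇ 1 ] + l)
degree-decrement-balance 0                   le = m≤n⇒m≤1+n le
degree-decrement-balance 1                   le = le
degree-decrement-balance 2                   le = s≤s le
degree-decrement-balance (suc (suc (suc _))) le = m≤n⇒m≤1+n le

module _ {m : ℕ} (T : Graph m) where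

  record IsNonBacktrackingWalk (w : ℕ → Fin m) : Set where
    field
      edge      : ∀ k → Edge T (w k) (w (suc k))
      no-return : ∀ k → w (suc (suc k)) ≢ w k

  nonbacktracking-walk : (P : Fin m → Set) → (∀ x y → P x → ∃ λ z → P z × Edge T x z × z ≢ y) →
                         ∀ {x₀} → P x₀ → ∃ IsNonBacktrackingWalk
  nonbacktracking-walk P next {x₀} p₀ = current ∘ state , record { edge = edge ; no-return = no-return }
    where
    record State : Set where
      field
        previous current : Fin m
        current∈P        : P current
    open State

    move : (s : State) → ∃ λ z → P z × Edge T (current s) z × z ≢ previous s
    move s = next (current s) (previous s) (current∈P s)

    state : ℕ → State
    state zero    = record { previous = x₀ ; current = x₀ ; current∈P = p₀ }
    state (suc k) = record { previous = current (state k) ; current = proj₁ (move (state k))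
                           ; current∈P = proj₁ (proj₂ (move (state k))) }

    edge : ∀ k → Edge T (current (state k)) (current (state (suc k)))
    edge k = proj₁ (proj₂ (proj₂ (move (state k))))

    no-return : ∀ k → current (state (suc (suc k))) ≢ current (state k)
    no-return k = proj₂ (proj₂ (proj₂ (move (state (suc k)))))

  -- The first repetition w i ≡ w (i + d + 1) is a loop (d = 0), a backtrack (d = 1) or a cycle.
  forest-has-no-nonbacktracking-walk : Forest T → ∀ {w} → ¬ IsNonBacktrackingWalk w
  forest-has-no-nonbacktracking-walk forest {w} record { edge = edge ; no-return = no-return }
    with first-repetition w
  ... | i , zero , repeat , _ =
    loop-free T (subst (Edge T (w i)) (trans (cong (w ∘ suc) (sym (+-identityʳ i))) (sym repeat)) (edge i))
  ... | i , suc zero , repeat , _ =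
    no-return i (sym (trans repeat (cong (w ∘ suc) (+-comm i 1))))
  ... | i , d@(suc (suc _)) , repeat , inj = forest d (s≤s (s≤s z≤n)) (λ t → w (i + toℕ t)) cycle
    where
    edge-at : ∀ {a b} → suc a ≡ b → Edge T (w a) (w b)
    edge-at {a} refl = edge a
    below : ∀ (t : Fin (suc d)) → i + toℕ t < suc (i + d)
    below t = s≤s (+-monoʳ-≤ i (m<1+n⇒m≤n (toℕ<n t)))
    cycle : IsCycle T d (λ t → w (i + toℕ t))
    cycle = record
      { injective = λ {s} {t} eq → toℕ-injective (+-cancelˡ-≡ i _ _ (inj (below s) (below t) eq))
      ; steps     = λ t → subst (λ a → Edge T (w (i + a)) (w (i + suc (toℕ t))))
                              (sym (toℕ-inject₁ t)) (edge-at (sym (+-suc i (toℕ t))))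
      ; closing   = subst₂ (λ a v → Edge T (w (i + a)) v)
                      (sym (toℕ-fromℕ d)) (trans (sym repeat) (cong w (sym (+-identityʳ i)))) (edge (i + d))
      }

  -- Branching nodes versus leaves

  degreeIn : (Fin m → Bool) → Fin m → ℕ
  degreeIn A x = count (λ y → adj T x y ∧ A y)

  forest-has-leaf : Forest T → (A : Fin m → Bool) → ∀ {x₀} → A x₀ ≡ true →
                    ∃ λ x → A x ≡ true × degreeIn A x ≤ 1
  forest-has-leaf forest A a₀ with any? (λ x → (A x ≟ᵇ true) ×-dec (degreeIn A x ≤? 1))
  ... | yes leaf = leaf
  ... | no ¬leaf = ⊥-elim (forest-has-no-nonbacktracking-walk forest
                             (proj₂ (nonbacktracking-walk (λ x → A x ≡ true) next a₀)))
    where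
    next : ∀ x y → A x ≡ true → ∃ λ z → A z ≡ true × Edge T x z × z ≢ y
    next x y ax with count-avoid (≰⇒> (λ d≤1 → ¬leaf (x , ax , d≤1))) y
    ... | z , xz∧az , z≢y = let xz , az = ∧-true⁻ xz∧az in z , az , xz , z≢y

  withDegree : (ℕ → Bool) → (Fin m → Bool) → Fin m → Bool
  withDegree h A x = A x ∧ h (degreeIn A x)

  withDegree-active : ∀ h {A : Fin m → Bool} {x} → A x ≡ true → withDegree h A x ≡ h (degreeIn A x)
  withDegree-active h ax rewrite ax = refl

  withDegree-erased : ∀ h A x → withDegree h (erase A x) x ≡ false
  withDegree-erased h A x rewrite erase-self A x = refl

  degreeIn-erase : ∀ {A : Fin m → Bool} {x} y → A x ≡ true → degreeIn A y ≡ [ adj T y x ] + degreeIn (erase A x) y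
  degreeIn-erase {A} {x} y ax =
    let R , eA , eA′ = count-split₁ {f = λ z → adj T y z ∧ A z} {g = λ z → adj T y z ∧ erase A x z}
                         (λ i i≢x → cong (adj T y i ∧_) (sym (erase-≢ {f = A} i≢x)))
                         (trans (cong (adj T y x ∧_) ax) (∧-identityʳ _))
                         (trans (cong (adj T y x ∧_) (erase-self A x)) (∧-zeroʳ _))
    in trans eA (cong ([ adj T y x ] +_) (sym eA′))

  withDegree-erase-far : ∀ h {A : Fin m → Bool} {x y} → A x ≡ true → y ≢ x → (A y ≡ true → adj T y x ≡ false) →
                         withDegree h A y ≡ withDegree h (erase A x) y
  withDegree-erase-far h {A} {x} {y} ax y≢x far rewrite erase-≢ {f = A} y≢x with A y
  ... | false = refl
  ... | true  = cong h (trans (degreeIn-erase y ax) (cong (λ b → [ b ] + degreeIn (erase A x) y) (far refl)))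

  inactive-neighbour : ∀ {A : Fin m → Bool} {x y} → adj T x y ∧ A y ≡ false → A y ≡ true → adj T y x ≡ false
  inactive-neighbour {A} {x} {y} xy∧ay≡false ay = begin
    adj T y x          ≡⟨ Graph.sym T y x ⟩
    adj T x y          ≡⟨ ∧-identityʳ _ ⟨
    adj T x y ∧ true   ≡⟨ cong (adj T x y ∧_) ay ⟨
    adj T x y ∧ A y    ≡⟨ xy∧ay≡false ⟩
    false              ∎
    where open ≡-Reasoning

  branchingIn leavesIn : (Fin m → Bool) → ℕ
  branchingIn A = count (withDegree (3 ≤ᵇ_) A)
  leavesIn    A = count (withDegree (_≤ᵇ 1) A)

  erase-isolated : ∀ {A : Fin m → Bool} {x} → A x ≡ true → degreeIn A x ≡ 0 →
                   branchingIn (erase A x) ≤ leavesIn (erase A x) → branchingIn A ≤ leavesIn A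
  erase-isolated {A} {x} ax dx≡0 ih =
    let _ , e₃ , e₃′ = split (3 ≤ᵇ_)
        _ , e₁ , e₁′ = split (_≤ᵇ 1)
    in subst₂ _≤_ (sym e₃) (sym e₁) (m≤n⇒m≤1+n (subst₂ _≤_ e₃′ e₁′ ih))
    where
    split : ∀ h → ∃ λ R → count (withDegree h A) ≡ [ h 0 ] + R × count (withDegree h (erase A x)) ≡ [ false ] + R
    split h = count-split₁ (λ i i≢x → withDegree-erase-far h ax i≢x (inactive-neighbour {A = A} (count≡0⁻ dx≡0 i)))
                (trans (withDegree-active h ax) (cong h dx≡0)) (withDegree-erased h A x)

  erase-pendant : ∀ {A : Fin m → Bool} {x} → A x ≡ true → degreeIn A x ≡ 1 →
                  branchingIn (erase A x) ≤ leavesIn (erase A x) → branchingIn A ≤ leavesIn A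
  erase-pendant {A} {x} ax dx≡1 ih =
    let _ , e₃ , e₃′ = split (3 ≤ᵇ_)
        _ , e₁ , e₁′ = split (_≤ᵇ 1)
    in subst₂ _≤_ (sym e₃) (sym e₁) (degree-decrement-balance d (subst₂ _≤_ e₃′ e₁′ ih))
    where
    neighbour : ∃ λ u → adj T x u ∧ A u ≡ true
    neighbour = count-witness (subst (0 <_) (sym dx≡1) z<s)
    u  = proj₁ neighbour
    xu = proj₁ (∧-true⁻ (proj₂ neighbour))
    au = proj₂ (∧-true⁻ (proj₂ neighbour))
    x≢u : x ≢ u
    x≢u x≡u = loop-free T (subst (Edge T x) (sym x≡u) xu)
    far : ∀ {y} → y ≢ u → A y ≡ true → adj T y x ≡ false
    far {y} y≢u ay with adj T x y ∧ A y in xy∧ay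
    ... | false = inactive-neighbour {A = A} xy∧ay ay
    ... | true  = ⊥-elim (y≢u (count-unique (≤-reflexive dx≡1) xy∧ay (proj₂ neighbour)))
    d = degreeIn (erase A x) u
    du : degreeIn A u ≡ suc d
    du = trans (degreeIn-erase u ax) (cong (λ b → [ b ] + d) (trans (Graph.sym T u x) xu))
    split : ∀ h → ∃ λ R → count (withDegree h A) ≡ [ h 1 ] + ([ h (suc d) ] + R)
                        × count (withDegree h (erase A x)) ≡ [ false ] + ([ h d ] + R)
    split h = count-split₂ x≢u (λ i i≢x i≢u → withDegree-erase-far h ax i≢x (far i≢u))
                (trans (withDegree-active h ax) (cong h dx≡1))
                (trans (withDegree-active h au) (cong h du))
                (withDegree-erased h A x)
                (withDegree-active h (trans (erase-≢ {f = A} (x≢u ∘ sym)) au))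

  erase-leaf : ∀ {A : Fin m → Bool} {x} → A x ≡ true → degreeIn A x ≤ 1 →
               branchingIn (erase A x) ≤ leavesIn (erase A x) → branchingIn A ≤ leavesIn A
  erase-leaf {A} {x} ax dx≤1 ih with degreeIn A x in dx
  erase-leaf ax z≤n       ih | zero     = erase-isolated ax dx ih
  erase-leaf ax (s≤s z≤n) ih | suc zero = erase-pendant ax dx ih

  branchingIn≤leavesIn : Forest T → ∀ k A → count A ≡ k → branchingIn A ≤ leavesIn A
  branchingIn≤leavesIn forest zero A |A|≡0 =
    ≤-trans (count-mono {g = A} (λ i → proj₁ ∘ ∧-true⁻)) (≤-trans (≤-reflexive |A|≡0) z≤n)
  branchingIn≤leavesIn forest (suc k) A |A|≡1+k =
    let x₀ , a₀       = count-witness {f = A} (subst (0 <_) (sym |A|≡1+k) z<s)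
        x , ax , dx≤1 = forest-has-leaf forest A a₀
    in erase-leaf ax dx≤1 (branchingIn≤leavesIn forest k (erase A x)
                             (cong pred (trans (sym (count-erase-active {f = A} ax)) |A|≡1+k)))

  branching≤leaves : Forest T → count (λ x → 3 ≤ᵇ degree T x) ≤ count (λ x → degree T x ≤ᵇ 1)
  branching≤leaves forest =
    subst₂ _≤_ (count-cong (cong (3 ≤ᵇ_) ∘ degreeIn-everything)) (count-cong (cong (_≤ᵇ 1) ∘ degreeIn-everything))
      (branchingIn≤leavesIn forest _ (λ _ → true) refl)
    where
    degreeIn-everything : ∀ x → degreeIn (λ _ → true) x ≡ degree T x
    degreeIn-everything x = trans (count-cong (∧-identityʳ ∘ adj T x)) (sym (∣tabulate∣≡count (adj T x)))

  a₁-edgeless : (∀ x y → adj T x y ≡ false) → a₁ T ≡ 0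
  a₁-edgeless edgeless = trans (∣tabulate∣≡count (λ x → 3 ≤ᵇ degree T x))
    (count≡0 λ x → cong (3 ≤ᵇ_) (trans (∣tabulate∣≡count (adj T x)) (count≡0 (edgeless x))))

module _ {n : ℕ} (G : Graph n) where

  clique? : Decidable (IsClique G)
  clique? S = all? λ i → all? λ j →
    (i ∈? S) →-dec (j ∈? S) →-dec ¬? (i ≟ᶠ j) →-dec (adj G i j ≟ᵇ true)

  clique-⊆-maximal : ∀ {S} → IsClique G S → ∃ λ F → IsMaximalClique G F × S ⊆ F
  clique-⊆-maximal {S} = extend S (⊃-wellFounded S)
    where
    extend : ∀ S → Acc _⊃_ S → IsClique G S → ∃ λ F → IsMaximalClique G F × S ⊆ F
    extend S (acc larger) S-clique with anySubset? (λ S′ → clique? S′ ×-dec (S ⊂? S′))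
    ... | yes (S′ , S′-clique , S⊂S′) =
      let F , F-maximal , S′⊆F = extend S′ (larger S⊂S′) S′-clique
      in F , F-maximal , ⊆-trans (proj₁ S⊂S′) S′⊆F
    ... | no ¬larger = S , (S-clique , maximal) , id
      where
      maximal : ∀ S′ → IsClique G S′ → S ⊆ S′ → S′ ≡ S
      maximal S′ S′-clique S⊆S′ = ⊆-antisym S′⊆S S⊆S′
        where
        S′⊆S : S′ ⊆ S
        S′⊆S {x} x∈S′ with x ∈? S
        ... | yes x∈S = x∈S
        ... | no x∉S  = ⊥-elim (¬larger (S′ , S′-clique , S⊆S′ , x , x∈S′ , x∉S))

  singleton-clique : ∀ v → IsClique G ⁅ v ⁆
  singleton-clique v i j i∈ j∈ i≢j = ⊥-elim (i≢j (trans (x∈⁅y⁆⇒x≡y v i∈) (sym (x∈⁅y⁆⇒x≡y v j∈))))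

  edge-clique : ∀ {v w} → Edge G v w → IsClique G (⁅ v ⁆ ∪ ⁅ w ⁆)
  edge-clique {v} {w} vw i j i∈ j∈ i≢j with x∈p∪q⁻ ⁅ v ⁆ ⁅ w ⁆ i∈ | x∈p∪q⁻ ⁅ v ⁆ ⁅ w ⁆ j∈
  ... | inj₁ i∈v | inj₂ j∈w rewrite x∈⁅y⁆⇒x≡y v i∈v | x∈⁅y⁆⇒x≡y w j∈w = vw
  ... | inj₂ i∈w | inj₁ j∈v rewrite x∈⁅y⁆⇒x≡y w i∈w | x∈⁅y⁆⇒x≡y v j∈v = trans (Graph.sym G w v) vw
  ... | inj₁ i∈v | inj₁ j∈v = singleton-clique v i j i∈v j∈v i≢j
  ... | inj₂ i∈w | inj₂ j∈w = singleton-clique w i j i∈w j∈w i≢j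

  edge-in-maximal-clique : ∀ {v w} → Edge G v w → ∃ λ F → IsMaximalClique G F × v ∈ F × w ∈ F
  edge-in-maximal-clique {v} {w} vw =
    let F , F-maximal , pair⊆F = clique-⊆-maximal (edge-clique vw)
    in F , F-maximal , pair⊆F (x∈p∪q⁺ (inj₁ (x∈⁅x⁆ v))) , pair⊆F (x∈p∪q⁺ (inj₂ (x∈⁅x⁆ w)))

  maximal-clique-nonempty : Fin n → ∀ {F} → IsMaximalClique G F → ∃ (_∈ F)
  maximal-clique-nonempty v₀ {F} (_ , maximal) with any? (_∈? F)
  ... | yes v∈F = v∈F
  ... | no F-empty = v₀ , subst (v₀ ∈_) (maximal ⁅ v₀ ⁆ (singleton-clique v₀) (λ {v} v∈F → ⊥-elim (F-empty (v , v∈F)))) (x∈⁅x⁆ v₀)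

-- Private vertices of leaf cliques

reach-source : ∀ {m} {T : Graph m} {P : Fin m → Set} {i j} → Reach T P i j → P i
reach-source (here p)     = p
reach-source (step p _ _) = p

module _ {n : ℕ} {G : Graph n} (𝒯 : CliqueForest G) where
  open CliqueForest 𝒯

  IsPrivate : Fin m → Fin n → Set
  IsPrivate x v = v ∈ K x × ∀ z → v ∈ K z → z ≡ x

  private-if-absent-from-neighbours : ∀ {x v} → v ∈ K x → (∀ y → Edge tree x y → v ∉ K y) → IsPrivate x v
  private-if-absent-from-neighbours {x} {v} v∈Kx absent = v∈Kx , λ z v∈Kz → stays (subtree v x z v∈Kx v∈Kz)
    where
    stays : ∀ {z} → Reach tree (λ l → v ∈ K l) x z → z ≡ x
    stays (here _)         = refl
    stays (step _ xy path) = ⊥-elim (absent _ xy (reach-source path))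

  leaf-private-vertex : Fin n → ∀ {x} → degree tree x ≤ 1 → ∃ (IsPrivate x)
  leaf-private-vertex v₀ {x} leaf with any? (λ u → adj tree x u ≟ᵇ true)
  ... | no isolated =
    let v , v∈Kx = maximal-clique-nonempty G v₀ (K-max x)
    in v , private-if-absent-from-neighbours v∈Kx (λ y xy → ⊥-elim (isolated (y , xy)))
  ... | yes (u , xu) with any? (λ v → (v ∈? K x) ×-dec ¬? (v ∈? K u))
  ...   | yes (v , v∈Kx , v∉Ku) = v , private-if-absent-from-neighbours v∈Kx only-u
    where
    only-u : ∀ y → Edge tree x y → v ∉ K y
    only-u y xy = subst (λ y → v ∉ K y) (count-unique (subst (_≤ 1) (∣tabulate∣≡count (adj tree x)) leaf) xu xy) v∉Ku
  ...   | no Kx⊈Ku = ⊥-elim (loop-free tree (subst (Edge tree x) u≡x xu))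
    where
    Kx⊆Ku : K x ⊆ K u
    Kx⊆Ku {v} v∈Kx with v ∈? K u
    ... | yes v∈Ku = v∈Ku
    ... | no v∉Ku  = ⊥-elim (Kx⊈Ku (v , v∈Kx , v∉Ku))
    u≡x : u ≡ x
    u≡x = K-inj (proj₂ (K-max x) (K u) (proj₁ (K-max u)) Kx⊆Ku)

  private-vertices-of-adjacent : ∀ {x y v w} → IsPrivate x v → IsPrivate y w → Edge G v w → x ≡ y
  private-vertices-of-adjacent (_ , v-only-x) (_ , w-only-y) vw =
    let F , F-maximal , v∈F , w∈F = edge-in-maximal-clique G vw
        z , Kz≡F = K-surj F F-maximal
    in trans (sym (v-only-x z (subst (_ ∈_) (sym Kz≡F) v∈F))) (w-only-y z (subst (_ ∈_) (sym Kz≡F) w∈F))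

  -- v₀ is a junk value on the non-leaves.
  leafPrivateVertex : Fin n → Fin m → Fin n
  leafPrivateVertex v₀ x with degree tree x ≤? 1
  ... | yes leaf = proj₁ (leaf-private-vertex v₀ leaf)
  ... | no _     = v₀

  leafPrivateVertex-private : ∀ v₀ {x} → (degree tree x ≤ᵇ 1) ≡ true → IsPrivate x (leafPrivateVertex v₀ x)
  leafPrivateVertex-private v₀ {x} isLeaf with degree tree x ≤? 1
  ... | yes leaf  = proj₂ (leaf-private-vertex v₀ leaf)
  ... | no ¬leaf  = ⊥-elim (¬leaf (≤ᵇ-true⇒≤ isLeaf))

  leafPrivateVertices : Fin n → Subset n
  leafPrivateVertices v₀ = image (λ x → degree tree x ≤ᵇ 1) (leafPrivateVertex v₀)

  leafPrivateVertices-independent : ∀ v₀ → IsIndependent G (leafPrivateVertices v₀)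
  leafPrivateVertices-independent v₀ i j i∈ j∈ with adj G i j in ij
  ... | false = refl
  ... | true  =
    let x , x-leaf , px≡i = ∈-image⁻ i∈
        y , y-leaf , py≡j = ∈-image⁻ j∈
        x≡y = private-vertices-of-adjacent (leafPrivateVertex-private v₀ {x} x-leaf) (leafPrivateVertex-private v₀ {y} y-leaf)
                (subst₂ (Edge G) (sym px≡i) (sym py≡j) ij)
        i≡j = trans (sym px≡i) (trans (cong (leafPrivateVertex v₀) x≡y) py≡j)
    in ⊥-elim (loop-free G (subst (Edge G i) (sym i≡j) ij))

  a₁≤∣leafPrivateVertices∣ : ∀ v₀ → a₁ tree ≤ ∣ leafPrivateVertices v₀ ∣
  a₁≤∣leafPrivateVertices∣ v₀ = begin
    a₁ tree                                        ≡⟨ ∣tabulate∣≡count (λ x → 3 ≤ᵇ degree tree x) ⟩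
    count (λ x → 3 ≤ᵇ degree tree x)               ≤⟨ branching≤leaves tree forest ⟩
    count (λ x → degree tree x ≤ᵇ 1)               ≤⟨ count≤∣image∣ {p = leafPrivateVertex v₀} distinct ⟩
    ∣ leafPrivateVertices v₀ ∣                     ∎
    where
    open ≤-Reasoning
    distinct : ∀ {x y} → (degree tree x ≤ᵇ 1) ≡ true → (degree tree y ≤ᵇ 1) ≡ true →
               leafPrivateVertex v₀ x ≡ leafPrivateVertex v₀ y → x ≡ y
    distinct {x} x-leaf y-leaf px≡py =
      let px∈Kx , _ = leafPrivateVertex-private v₀ x-leaf
          _ , py-only-y = leafPrivateVertex-private v₀ y-leaf
      in py-only-y x (subst (_∈ K x) px≡py px∈Kx)

clique-forest-without-vertices-edgeless : {G : Graph 0} (𝒯 : CliqueForest G) →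
                                          ∀ x y → adj (CliqueForest.tree 𝒯) x y ≡ false
clique-forest-without-vertices-edgeless 𝒯 x y =
  subst (λ z → adj tree x z ≡ false) (K-inj (only-subset (K x) (K y))) (irrefl tree x)
  where
  open CliqueForest 𝒯
  only-subset : (S S′ : Subset 0) → S ≡ S′
  only-subset [] [] = refl

lemma22 : ∀ {n : ℕ} (G : Graph n) → Chordal G → (𝒯 : CliqueForest G) →
            ∃ λ (S : Subset n) → IsIndependent G S × a₁ (CliqueForest.tree 𝒯) ≤ ∣ S ∣
lemma22 {zero}  G _ 𝒯 =
  [] , (λ ()) , ≤-reflexive (a₁-edgeless (CliqueForest.tree 𝒯) (clique-forest-without-vertices-edgeless 𝒯))
lemma22 {suc n} G _ 𝒯 =
  leafPrivateVertices 𝒯 zero , leafPrivateVertices-independent 𝒯 zero , a₁≤∣leafPrivateVertices∣ 𝒯 zero
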